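{- Let $(h,n)=(4,2)$ and $U=K\times\{id\}\le S_4\times S_2$, where $K=\{id,(12)(34),(13)(24),(14)(23)\}\le S_4$ is the Klein group. Then $U$ is regular, but $U$ is neither a symmetry group nor an anonymity group with respect to $(4,2)$.
   Context: Let $G=S_h\times S_n$, $\mathcal P=(S_n)^h$, with $G$ acting on $\mathcal P$: $p^{(\varphi,\psi)}$ has $i$-th component $\psi\,p_{\varphi^{ -1}(i)}$ (products are compositions). A subgroup $U\le G$ is regular if $\mathrm{Stab}_U(p)=\{u\in U:p^u=p\}\subseteq S_h\times\{id\}$ for every $p\in\mathcal P$. An SPF is a map $F:\mathcal P\to S_n$; its symmetry group is $G(F)=\{(\varphi,\psi)\in G:F(p^{(\varphi,\psi)})=\psi F(p)\ \forall p\}$ and its anonymity group is $G_1(F)=G(F)\cap(S_h\times\{id\})$. $U$ is a symmetry group (resp. anonymity group) if $U=G(F)$ (resp. $U=G_1(F)$) for some SPF $F$. -}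

module Defs where

open import Data.Nat using (ℕ)
open import Data.Fin using (Fin; zero; suc)
open import Data.Fin.Permutation as P
  using (Permutation′; _⟨$⟩ʳ_; _⟨$⟩ˡ_; _∘ₚ_; flip) renaming (id to idₚ)
open import Data.Product using (_×_; Σ; _,_; proj₂)
open import Data.Sum using (_⊎_)
open import Relation.Binary.PropositionalEquality using (_≡_)

Sym : ℕ → Set
Sym n = Permutation′ n

Grp : ℕ → ℕ → Set
Grp h n = Sym h × Sym n

Profile : ℕ → ℕ → Set
Profile h n = Fin h → Sym n

_≈ᴾ_ : ∀ {h n} → Profile h n → Profile h n → Set
p ≈ᴾ q = ∀ i → p i P.≈ q i

-- action: (p^(φ,ψ))_i = ψ ∘ p_{φ⁻¹(i)}   (_∘ₚ_ is diagrammatic: π ∘ₚ ρ = "first π then ρ")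
act : ∀ {h n} → Profile h n → Grp h n → Profile h n
act p (φ , ψ) i = p (φ ⟨$⟩ˡ i) ∘ₚ ψ

Subset : ℕ → ℕ → Set₁
Subset h n = Grp h n → Set

IsRegular : ∀ {h n} → Subset h n → Set
IsRegular {h} {n} U = ∀ (p : Profile h n) (φ : Sym h) (ψ : Sym n) →
  U (φ , ψ) → act p (φ , ψ) ≈ᴾ p → ψ P.≈ idₚ

SPF : ℕ → ℕ → Set
SPF h n = Profile h n → Sym n

Respects : ∀ {h n} → SPF h n → Set
Respects {h} {n} F = ∀ (p q : Profile h n) → p ≈ᴾ q → F p P.≈ F q

InSymGroup : ∀ {h n} → SPF h n → Grp h n → Set
InSymGroup {h} {n} F g = ∀ (p : Profile h n) → F (act p g) P.≈ (F p ∘ₚ proj₂ g)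

InAnonGroup : ∀ {h n} → SPF h n → Grp h n → Set
InAnonGroup F g = InSymGroup F g × (proj₂ g P.≈ idₚ)

_⇔_ : Set → Set → Set
A ⇔ B = (A → B) × (B → A)

IsSymmetryGroup : ∀ {h n} → Subset h n → Set
IsSymmetryGroup {h} {n} U = Σ (SPF h n) λ F → Respects F × (∀ g → U g ⇔ InSymGroup F g)

IsAnonymityGroup : ∀ {h n} → Subset h n → Set
IsAnonymityGroup {h} {n} U = Σ (SPF h n) λ F → Respects F × (∀ g → U g ⇔ InAnonGroup F g)

-- Klein four-group in S_4 (points 1..4 of the paper are 0..3 here)
k12-34 k13-24 k14-23 : Fin 4 → Fin 4
k12-34 zero = suc zero
k12-34 (suc zero) = zero
k12-34 (suc (suc zero)) = suc (suc (suc zero))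
k12-34 (suc (suc (suc zero))) = suc (suc zero)
k13-24 zero = suc (suc zero)
k13-24 (suc zero) = suc (suc (suc zero))
k13-24 (suc (suc zero)) = zero
k13-24 (suc (suc (suc zero))) = suc zero
k14-23 zero = suc (suc (suc zero))
k14-23 (suc zero) = suc (suc zero)
k14-23 (suc (suc zero)) = suc zero
k14-23 (suc (suc (suc zero))) = zero

_isFun_ : Sym 4 → (Fin 4 → Fin 4) → Set
φ isFun f = ∀ i → φ ⟨$⟩ʳ i ≡ f i

InKlein : Sym 4 → Set
InKlein φ = (φ isFun (λ i → i)) ⊎ (φ isFun k12-34) ⊎ (φ isFun k13-24) ⊎ (φ isFun k14-23)

KleinU : Subset 4 2
KleinU (φ , ψ) = InKlein φ × (ψ P.≈ idₚ)

{-# OPTIONS --safe #-}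
-- With two alternatives S₂ ≅ Bool, so an SPF F respecting profile equality is
-- determined by a Boolean function of the ballots, and (φ , id) ∈ G(F) iff that
-- function is invariant under permuting the voters by φ. The Klein group K splits
-- the balanced ballots of four voters into the orbits {1100, 0011}, {1010, 0101} and
-- {1001, 0110}; the function agrees on two of them, and the transposition merging
-- those two orbits then fixes it, because it maps every other ballot into its own
-- K-orbit. So G(F) always contains a transposition outside K. As U has trivial
-- S_n-part it is regular, and being a symmetry or an anonymity group would both
-- mean U ∩ (S_h × {id}) = G₁(F) for some F.
module Submission where

open import Defs
open import Data.Product using (_×_)
open import Relation.Nullary using (¬_)

open import Data.Bool using (Bool; true; false)
open import Data.Empty using (⊥-elim)
open import Data.Fin using (Fin)
open import Data.Fin.Patterns using (0F; 1F; 2F; 3F)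
open import Data.Fin.Permutation as P
  using (_⟨$⟩ʳ_; _⟨$⟩ˡ_; _∘ₚ_; permutation; transpose) renaming (id to idₚ)
open import Data.Fin.Properties using (_≟_; all?; 0≢1+n)
open import Data.Product using (Σ-syntax; _,_; proj₁; proj₂)
open import Data.Sum using (_⊎_; inj₁; inj₂)
open import Data.Vec.Functional using (_∷_; [])
open import Function using (_∘_)
open import Function.Bundles using (Injection)
open import Function.Properties.Inverse using (↔⇒↣)
open import Relation.Binary.PropositionalEquality
open import Relation.Nullary.Decidable using (True; toWitness)

anonymous⇒regular : ∀ {h n} {U : Subset h n} →
                    (∀ {φ ψ} → U (φ , ψ) → ψ P.≈ idₚ) → IsRegular U
anonymous⇒regular anon _ _ _ u _ = anon u

AnonymousPartRealisable : ∀ {h n} → Subset h n → Set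
AnonymousPartRealisable {h} {n} U =
  Σ[ F ∈ SPF h n ] Respects F × (∀ φ → U (φ , idₚ) ⇔ InSymGroup F (φ , idₚ))

symmetryGroup⇒anonymousPartRealisable : ∀ {h n} {U : Subset h n} →
  IsSymmetryGroup U → AnonymousPartRealisable U
symmetryGroup⇒anonymousPartRealisable (F , respects , U⇔G) =
  F , respects , λ φ → U⇔G (φ , idₚ)

anonymityGroup⇒anonymousPartRealisable : ∀ {h n} {U : Subset h n} →
  IsAnonymityGroup U → AnonymousPartRealisable U
anonymityGroup⇒anonymousPartRealisable (F , respects , U⇔G₁) =
  F , respects , λ φ → (λ u → proj₁ (proj₁ (U⇔G₁ (φ , idₚ)) u))
                     , (λ g → proj₂ (U⇔G₁ (φ , idₚ)) (g , λ _ → refl))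

toBit : Fin 2 → Bool
toBit 0F = false
toBit 1F = true

bit : Sym 2 → Bool
bit π = toBit (π ⟨$⟩ʳ 0F)

fromBit : Bool → Sym 2
fromBit false = idₚ
fromBit true  = transpose 0F 1F

bit-cong : ∀ {π ρ : Sym 2} → π P.≈ ρ → bit π ≡ bit ρ
bit-cong π≈ρ = cong toBit (π≈ρ 0F)

fromBit-bit : (π : Sym 2) → π P.≈ fromBit (bit π)
fromBit-bit π with π ⟨$⟩ʳ 0F in π0 | π ⟨$⟩ʳ 1F in π1
... | 0F | 1F = λ { 0F → π0 ; 1F → π1 }
... | 1F | 0F = λ { 0F → π0 ; 1F → π1 }
... | 0F | 0F = ⊥-elim (0≢1+n (injective (trans π0 (sym π1))))
  where open Injection (↔⇒↣ π)
... | 1F | 1F = ⊥-elim (0≢1+n (injective (trans π0 (sym π1))))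
  where open Injection (↔⇒↣ π)

bit-injective : ∀ {π ρ : Sym 2} → bit π ≡ bit ρ → π P.≈ ρ
bit-injective {π} {ρ} bπ≡bρ i =
  trans (fromBit-bit π i)
        (trans (cong (λ b → fromBit b ⟨$⟩ʳ i) bπ≡bρ) (sym (fromBit-bit ρ i)))

Invariant : ∀ {h} {A B : Set} → (Fin h → Fin h) → ((Fin h → A) → B) → Set
Invariant σ f = ∀ v → f (v ∘ σ) ≡ f v

outcome : ∀ {h} → SPF h 2 → (Fin h → Bool) → Bool
outcome F v = bit (F (fromBit ∘ v))

module _ {h} (F : SPF h 2) (respects : Respects F) where

  bit-F-cong : ∀ p q → p ≈ᴾ q → bit (F p) ≡ bit (F q)
  bit-F-cong p q p≈q = bit-cong {F p} {F q} (respects p q p≈q)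

  outcome-cong : ∀ {v w} → v ≗ w → outcome F v ≡ outcome F w
  outcome-cong {v} {w} v≗w =
    bit-F-cong (fromBit ∘ v) (fromBit ∘ w) λ i j → cong (λ b → fromBit b ⟨$⟩ʳ j) (v≗w i)

  InSymGroup⇔Invariant : ∀ φ → InSymGroup F (φ , idₚ) ⇔ Invariant (φ ⟨$⟩ˡ_) (outcome F)
  InSymGroup⇔Invariant φ = symmetric⇒invariant , invariant⇒symmetric
    where
    symmetric⇒invariant : InSymGroup F (φ , idₚ) → Invariant (φ ⟨$⟩ˡ_) (outcome F)
    symmetric⇒invariant φ∈G v =
      trans (bit-F-cong (fromBit ∘ v ∘ (φ ⟨$⟩ˡ_)) p λ _ _ → refl)
            (bit-cong {F p} {F (fromBit ∘ v) ∘ₚ idₚ} (φ∈G (fromBit ∘ v)))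
      where
      p : Profile h 2
      p = act (fromBit ∘ v) (φ , idₚ)

    invariant⇒symmetric : Invariant (φ ⟨$⟩ˡ_) (outcome F) → InSymGroup F (φ , idₚ)
    invariant⇒symmetric φ-inv p = bit-injective {F (act p (φ , idₚ))} {F p ∘ₚ idₚ} (begin
      bit (F (act p (φ , idₚ)))
        ≡⟨ bit-F-cong _ (fromBit ∘ bits ∘ (φ ⟨$⟩ˡ_)) (p≈bits ∘ (φ ⟨$⟩ˡ_)) ⟩
      outcome F (bits ∘ (φ ⟨$⟩ˡ_)) ≡⟨ φ-inv bits ⟩
      outcome F bits               ≡⟨ bit-F-cong p (fromBit ∘ bits) p≈bits ⟨
      bit (F p)                    ∎)
      where
      open ≡-Reasoning
      bits : Fin h → Bool
      bits = bit ∘ p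
      p≈bits : p ≈ᴾ (fromBit ∘ bits)
      p≈bits = fromBit-bit ∘ p

curry₄ : ∀ {A B : Set} → ((Fin 4 → A) → B) → A → A → A → A → B
curry₄ f a b c d = f (a ∷ b ∷ c ∷ d ∷ [])

Invariant₄ : ∀ {A B : Set} → (Fin 4 → Fin 4) → (A → A → A → A → B) → Set
Invariant₄ σ g = ∀ a b c d → let v = a ∷ b ∷ c ∷ d ∷ [] in
  g (v (σ 0F)) (v (σ 1F)) (v (σ 2F)) (v (σ 3F)) ≡ g a b c d

tabulate₄ : ∀ {A : Set} (v : Fin 4 → A) → v ≗ v 0F ∷ v 1F ∷ v 2F ∷ v 3F ∷ []
tabulate₄ v 0F = refl
tabulate₄ v 1F = refl
tabulate₄ v 2F = refl
tabulate₄ v 3F = refl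

module _ {A B : Set} {f : (Fin 4 → A) → B} (f-cong : ∀ {v w} → v ≗ w → f v ≡ f w) where

  Invariant⇔Invariant₄ : ∀ σ → Invariant σ f ⇔ Invariant₄ σ (curry₄ f)
  Invariant⇔Invariant₄ σ = invariant⇒invariant₄ , invariant₄⇒invariant
    where
    invariant⇒invariant₄ : Invariant σ f → Invariant₄ σ (curry₄ f)
    invariant⇒invariant₄ σ-inv a b c d =
      trans (sym (f-cong (tabulate₄ (v ∘ σ)))) (σ-inv v)
      where
      v : Fin 4 → A
      v = a ∷ b ∷ c ∷ d ∷ []

    invariant₄⇒invariant : Invariant₄ σ (curry₄ f) → Invariant σ f
    invariant₄⇒invariant σ-inv v = begin
      f (v ∘ σ)
        ≡⟨ f-cong (tabulate₄ v ∘ σ) ⟩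
      f (w ∘ σ)
        ≡⟨ f-cong (tabulate₄ (w ∘ σ)) ⟩
      curry₄ f (w (σ 0F)) (w (σ 1F)) (w (σ 2F)) (w (σ 3F))
        ≡⟨ σ-inv (v 0F) (v 1F) (v 2F) (v 3F) ⟩
      f w
        ≡⟨ f-cong (tabulate₄ v) ⟨
      f v
        ∎
      where
      open ≡-Reasoning
      w : Fin 4 → A
      w = v 0F ∷ v 1F ∷ v 2F ∷ v 3F ∷ []

KleinInvariant : ∀ {A B : Set} → (A → A → A → A → B) → Set
KleinInvariant g = Invariant₄ k12-34 g × Invariant₄ k13-24 g × Invariant₄ k14-23 g

-- K is normal in S₄, so relabelling the voters preserves K-invariance.
KleinInvariant-∘34 : ∀ {A B : Set} {g : A → A → A → A → B} →
  KleinInvariant g → KleinInvariant (λ a b c d → g a b d c)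
KleinInvariant-∘34 (k₁ , k₂ , k₃) =
  (λ a b c d → k₁ a b d c) , (λ a b c d → k₃ a b d c) , (λ a b c d → k₂ a b d c)

KleinInvariant-∘243 : ∀ {A B : Set} {g : A → A → A → A → B} →
  KleinInvariant g → KleinInvariant (λ a b c d → g a d b c)
KleinInvariant-∘243 (k₁ , k₂ , k₃) =
  (λ a b c d → k₂ a d b c) , (λ a b c d → k₃ a d b c) , (λ a b c d → k₁ a d b c)

-- Voters are numbered 1–4 as in the paper: τᵢⱼ swaps the 0-based points i − 1 and j − 1.
τ₂₃ τ₂₄ τ₃₄ : Sym 4
τ₂₃ = transpose 1F 2F
τ₂₄ = transpose 1F 3F
τ₃₄ = transpose 2F 3F

KleinInvariant⇒τ₂₃-invariant : ∀ {g : Bool → Bool → Bool → Bool → Bool} → KleinInvariant g →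
  g true true false false ≡ g true false true false → Invariant₄ (τ₂₃ ⟨$⟩ˡ_) g
KleinInvariant⇒τ₂₃-invariant {g} (k₁ , k₂ , k₃) eq = swap
  where
  g0011≡g0101 : g false false true true ≡ g false true false true
  g0011≡g0101 = trans (k₂ true true false false) (trans eq (sym (k₁ true false true false)))

  -- Unless b ≠ c and a ≠ d, swapping b and c is trivial or agrees with (14)(23).
  swap : Invariant₄ (τ₂₃ ⟨$⟩ˡ_) g
  swap a     false false d     = refl
  swap a     true  true  d     = refl
  swap false b     c     false = k₃ false b c false
  swap true  b     c     true  = k₃ true b c true
  swap true  true  false false = sym eq
  swap true  false true  false = eq
  swap false true  false true  = g0011≡g0101
  swap false false true  true  = sym g0011≡g0101

two-of-three-equal : (x y z : Bool) → x ≡ y ⊎ x ≡ z ⊎ y ≡ z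
two-of-three-equal false false _     = inj₁ refl
two-of-three-equal true  true  _     = inj₁ refl
two-of-three-equal false true  false = inj₂ (inj₁ refl)
two-of-three-equal true  false true  = inj₂ (inj₁ refl)
two-of-three-equal false true  true  = inj₂ (inj₂ refl)
two-of-three-equal true  false false = inj₂ (inj₂ refl)

Klein-stabiliser-of-0 : ∀ {φ} → InKlein φ → φ ⟨$⟩ʳ 0F ≡ 0F → φ P.≈ idₚ
Klein-stabiliser-of-0 (inj₁ φ≗id)               _    = φ≗id
Klein-stabiliser-of-0 (inj₂ (inj₁ φ≗k))         φ0≡0 = ⊥-elim (0≢1+n (trans (sym φ0≡0) (φ≗k 0F)))
Klein-stabiliser-of-0 (inj₂ (inj₂ (inj₁ φ≗k)))  φ0≡0 = ⊥-elim (0≢1+n (trans (sym φ0≡0) (φ≗k 0F)))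
Klein-stabiliser-of-0 (inj₂ (inj₂ (inj₂ φ≗k)))  φ0≡0 = ⊥-elim (0≢1+n (trans (sym φ0≡0) (φ≗k 0F)))

fixes-0-moves⇒∉Klein : ∀ φ → φ ⟨$⟩ʳ 0F ≡ 0F → (i : Fin 4) → φ ⟨$⟩ʳ i ≢ i → ¬ InKlein φ
fixes-0-moves⇒∉Klein φ φ0≡0 i φi≢i φ∈K = φi≢i (Klein-stabiliser-of-0 {φ} φ∈K φ0≡0 i)

KleinInvariant⇒transposition-invariant : ∀ {g : Bool → Bool → Bool → Bool → Bool} →
  KleinInvariant g → Σ[ τ ∈ Sym 4 ] ¬ InKlein τ × Invariant₄ (τ ⟨$⟩ˡ_) g
KleinInvariant⇒transposition-invariant {g} K
  with two-of-three-equal (g true true false false) (g true false true false) (g true false false true)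
... | inj₁ eq =
  τ₂₃ , fixes-0-moves⇒∉Klein τ₂₃ refl 1F (λ ()) , KleinInvariant⇒τ₂₃-invariant K eq
... | inj₂ (inj₁ eq) =
  τ₂₄ , fixes-0-moves⇒∉Klein τ₂₄ refl 1F (λ ()) ,
  λ a b c d → KleinInvariant⇒τ₂₃-invariant (KleinInvariant-∘34 K) eq a b d c
... | inj₂ (inj₂ eq) =
  τ₃₄ , fixes-0-moves⇒∉Klein τ₃₄ refl 2F (λ ()) ,
  λ a b c d → KleinInvariant⇒τ₂₃-invariant (KleinInvariant-∘243 K) eq a c d b

involution : ∀ {n} (f : Fin n → Fin n) → {True (all? λ i → f (f i) ≟ i)} → Sym n
involution f {f²≡id} = permutation f f (toWitness f²≡id) (toWitness f²≡id)

K₁ K₂ K₃ : Sym 4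
K₁ = involution k12-34
K₂ = involution k13-24
K₃ = involution k14-23

InSymGroup⇔Invariant₄ : (F : SPF 4 2) → Respects F →
  ∀ φ → InSymGroup F (φ , idₚ) ⇔ Invariant₄ (φ ⟨$⟩ˡ_) (curry₄ (outcome F))
InSymGroup⇔Invariant₄ F respects φ =
  let (symmetric⇒invariant , invariant⇒symmetric) = InSymGroup⇔Invariant F respects φ
      (invariant⇒invariant₄ , invariant₄⇒invariant) =
        Invariant⇔Invariant₄ (outcome-cong F respects) (φ ⟨$⟩ˡ_)
  in invariant⇒invariant₄ ∘ symmetric⇒invariant , invariant⇒symmetric ∘ invariant₄⇒invariant

KleinU-anonymousPart-not-realisable : ¬ AnonymousPartRealisable KleinU
KleinU-anonymousPart-not-realisable (F , respects , U⇔G) =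
  let (τ , τ∉K , τ-invariant) = KleinInvariant⇒transposition-invariant
        ( Klein-invariant K₁ (inj₂ (inj₁ λ _ → refl) , λ _ → refl)
        , Klein-invariant K₂ (inj₂ (inj₂ (inj₁ λ _ → refl)) , λ _ → refl)
        , Klein-invariant K₃ (inj₂ (inj₂ (inj₂ λ _ → refl)) , λ _ → refl))
  in τ∉K (proj₁ (proj₂ (U⇔G τ) (proj₂ (InSymGroup⇔Invariant₄ F respects τ) τ-invariant)))
  where
  Klein-invariant : ∀ φ → KleinU (φ , idₚ) → Invariant₄ (φ ⟨$⟩ˡ_) (curry₄ (outcome F))
  Klein-invariant φ φ∈U = proj₁ (InSymGroup⇔Invariant₄ F respects φ) (proj₁ (U⇔G φ) φ∈U)

proposition33 : IsRegular KleinU × ¬ IsSymmetryGroup KleinU × ¬ IsAnonymityGroup KleinU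
proposition33 =
  anonymous⇒regular proj₂ ,
  KleinU-anonymousPart-not-realisable ∘ symmetryGroup⇒anonymousPartRealisable ,
  KleinU-anonymousPart-not-realisable ∘ anonymityGroup⇒anonymousPartRealisable
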